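{- For every $m\ge 0$, $X(m+1)=(A(m)X(m))^T$.
   Context: Consider walks in $\mathbb{Z}^2$ starting at $(2,1)$ in which every step has the form $(c,d)\to(d+1,i)$ for some $i\in\{1,\dots,c\}$. For $m\ge 0$, $X(m)$ is the $\lfloor\frac{m+2}{2}\rfloor\times\lceil\frac{m+2}{2}\rceil$ matrix (rows and columns indexed from $1$) whose entry $X(m)_{i-1,j}$ is the number of such walks of length $m$ that end at $(i,j)$. $A(m)$ is the $(\lfloor\frac{m+2}{2}\rfloor+1)\times\lfloor\frac{m+2}{2}\rfloor$ matrix with $A(m)_{1,c}=1$ for all $c$ and, for $r\ge 2$, $A(m)_{r,c}=1$ if $c\ge r-1$ and $0$ otherwise (an upper triangular matrix of all ones with a row of ones appended on top). -}

module Defs where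

open import Data.Nat using (ℕ; zero; suc; _+_; _*_; _≤_; ⌊_/2⌋; ⌈_/2⌉)
open import Data.Nat.Properties using (_≟_; _≤?_)
open import Data.Fin using (Fin; toℕ) renaming (zero to fzero; suc to fsuc)
open import Data.Product using (_×_; _,_)
open import Relation.Nullary using (yes; no)

sumFin : (n : ℕ) → (Fin n → ℕ) → ℕ
sumFin zero    f = 0
sumFin (suc n) f = f fzero + sumFin n (λ k → f (fsuc k))

sum1to : ℕ → (ℕ → ℕ) → ℕ
sum1to zero    f = 0
sum1to (suc c) f = sum1to c f + f (suc c)

same : ℕ × ℕ → ℕ × ℕ → ℕ
same (a , b) (c , d) with a ≟ c | b ≟ d
... | yes _ | yes _ = 1
... | _     | _     = 0

-- walks m p q: number of walks of length m from p to q, where each step is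
-- (c,d) → (d+1, i) with i ∈ {1,…,c}.
walks : ℕ → ℕ × ℕ → ℕ × ℕ → ℕ
walks zero    p       q = same p q
walks (suc m) (c , d) q = sum1to c (λ i → walks m (suc d , i) q)

rows : ℕ → ℕ
rows m = ⌊ suc (suc m) /2⌋

cols : ℕ → ℕ
cols m = ⌈ suc (suc m) /2⌉

Matrix : ℕ → ℕ → Set
Matrix r c = Fin r → Fin c → ℕ

-- X(m)_{i-1,j} = #walks of length m from (2,1) to (i,j)  (1-based indices);
-- with 0-based Fin indices r, j: entry (r,j) counts walks ending at (r+2, j+1).
X : (m : ℕ) → Matrix (rows m) (cols m)
X m r j = walks m (2 , 1) (suc (suc (toℕ r)) , suc (toℕ j))

-- A(m): first row all ones; for 1-based r ≥ 2, entry (r,c) is 1 iff c ≥ r-1.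
-- With 0-based r0, c0: row 0 all ones; row suc r0 has 1 iff c0+1 ≥ r0+1.
A : (m : ℕ) → Matrix (suc (rows m)) (rows m)
A m fzero    c = 1
A m (fsuc r) c with suc (toℕ r) ≤? suc (toℕ c)
... | yes _ = 1
... | no  _ = 0

_⊗_ : ∀ {p q s} → Matrix p q → Matrix q s → Matrix p s
_⊗_ {q = q} M N i j = sumFin q (λ k → M i k * N k j)

transpose : ∀ {p q} → Matrix p q → Matrix q p
transpose M i j = M j i

-- Split a walk of length m+1 at its last step instead of its first: the last step into
-- (e+1, f+1) comes from some (c, e) with f+1 ≤ c, so a walk count at (e+1, f+1) is the
-- sum of the counts at (c, e) over c ≥ f+1.  Walks from (2,1) never visit the line x = 1
-- and stay in the box 2 ≤ x ≤ rows m + 1, 1 ≤ y ≤ cols m, so for the end point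
-- (i+2, j+1) this sum is row j of A(m) against column i of X(m).
module Submission where

open import Defs
open import Data.Nat using (ℕ; zero; suc; _+_; _*_; _≤_; _<_; z≤n; s≤s)
open import Data.Nat.Properties
open import Data.Fin using (Fin; toℕ) renaming (zero to fzero; suc to fsuc)
open import Data.Product using (_,_)
open import Data.Sum using (_⊎_; inj₁; inj₂)
open import Function using (_∘_)
open import Relation.Nullary using (yes; no; contradiction)
open import Relation.Binary.PropositionalEquality
open import Algebra.Properties.CommutativeSemigroup +-commutativeSemigroup using (interchange)
open import Algebra.Properties.CommutativeSemigroup *-commutativeSemigroup using (x∙yz≈z∙xy)
open ≡-Reasoning

𝟙[_≡_] : ℕ → ℕ → ℕ
𝟙[ zero  ≡ zero  ] = 1
𝟙[ zero  ≡ suc _ ] = 0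
𝟙[ suc _ ≡ zero  ] = 0
𝟙[ suc a ≡ suc b ] = 𝟙[ a ≡ b ]

𝟙[_≤_] : ℕ → ℕ → ℕ
𝟙[ zero  ≤ _     ] = 1
𝟙[ suc _ ≤ zero  ] = 0
𝟙[ suc a ≤ suc b ] = 𝟙[ a ≤ b ]

𝟙[≡]-refl : ∀ a → 𝟙[ a ≡ a ] ≡ 1
𝟙[≡]-refl zero    = refl
𝟙[≡]-refl (suc a) = 𝟙[≡]-refl a

𝟙[≡]-≢ : ∀ {a b} → a ≢ b → 𝟙[ a ≡ b ] ≡ 0
𝟙[≡]-≢ {zero}  {zero}  a≢b = contradiction refl a≢b
𝟙[≡]-≢ {zero}  {suc b} a≢b = refl
𝟙[≡]-≢ {suc a} {zero}  a≢b = refl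
𝟙[≡]-≢ {suc a} {suc b} a≢b = 𝟙[≡]-≢ (a≢b ∘ cong suc)

𝟙[≡]*-cong : ∀ a b {u v} → (a ≡ b → u ≡ v) → 𝟙[ a ≡ b ] * u ≡ 𝟙[ a ≡ b ] * v
𝟙[≡]*-cong a b u≡v with a ≟ b
... | yes a≡b = cong (𝟙[ a ≡ b ] *_) (u≡v a≡b)
... | no  a≢b rewrite 𝟙[≡]-≢ a≢b = refl

𝟙[≤]-≤ : ∀ {a b} → a ≤ b → 𝟙[ a ≤ b ] ≡ 1
𝟙[≤]-≤ z≤n       = refl
𝟙[≤]-≤ (s≤s a≤b) = 𝟙[≤]-≤ a≤b

𝟙[≤]-> : ∀ {a b} → b < a → 𝟙[ a ≤ b ] ≡ 0
𝟙[≤]-> {suc a} {zero}  b<a       = refl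
𝟙[≤]-> {suc a} {suc b} (s≤s b<a) = 𝟙[≤]-> b<a

𝟙[≤]-split : ∀ a b → 𝟙[ suc a ≤ b ] + 𝟙[ b ≡ a ] ≡ 𝟙[ a ≤ b ]
𝟙[≤]-split zero    zero    = refl
𝟙[≤]-split zero    (suc b) = refl
𝟙[≤]-split (suc a) zero    = refl
𝟙[≤]-split (suc a) (suc b) = 𝟙[≤]-split a b

same≡𝟙*𝟙 : ∀ a b c d → same (a , b) (c , d) ≡ 𝟙[ a ≡ c ] * 𝟙[ b ≡ d ]
same≡𝟙*𝟙 a b c d with a ≟ c | b ≟ d
... | yes refl | yes refl rewrite 𝟙[≡]-refl a | 𝟙[≡]-refl b = refl
... | yes refl | no  b≢d  rewrite 𝟙[≡]-refl a | 𝟙[≡]-≢ b≢d = refl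
... | no  a≢c  | _        rewrite 𝟙[≡]-≢ a≢c = refl

same-refl : ∀ a b → same (a , b) (a , b) ≡ 1
same-refl a b rewrite same≡𝟙*𝟙 a b a b | 𝟙[≡]-refl a | 𝟙[≡]-refl b = refl

sum1to-cong : ∀ n {f g : ℕ → ℕ} → (∀ i → i < n → f (suc i) ≡ g (suc i)) →
              sum1to n f ≡ sum1to n g
sum1to-cong zero    f≡g = refl
sum1to-cong (suc n) f≡g =
  cong₂ _+_ (sum1to-cong n (λ i i<n → f≡g i (m<n⇒m<1+n i<n))) (f≡g n ≤-refl)

sum1to-zero : ∀ n (f : ℕ → ℕ) → (∀ i → i < n → f (suc i) ≡ 0) → sum1to n f ≡ 0
sum1to-zero zero    f f≡0 = refl
sum1to-zero (suc n) f f≡0 =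
  cong₂ _+_ (sum1to-zero n f (λ i i<n → f≡0 i (m<n⇒m<1+n i<n))) (f≡0 n ≤-refl)

sum1to-zero⁻ : ∀ n (f : ℕ → ℕ) → sum1to n f ≡ 0 → ∀ i → i < n → f (suc i) ≡ 0
sum1to-zero⁻ (suc n) f Σ≡0 i (s≤s i≤n) with m≤n⇒m<n∨m≡n i≤n
... | inj₁ i<n  = sum1to-zero⁻ n f (m+n≡0⇒m≡0 _ Σ≡0) i i<n
... | inj₂ refl = m+n≡0⇒n≡0 (sum1to n f) Σ≡0

sum1to-+ : ∀ n (f g : ℕ → ℕ) → sum1to n (λ i → f i + g i) ≡ sum1to n f + sum1to n g
sum1to-+ zero    f g = refl
sum1to-+ (suc n) f g = trans (cong (_+ (f (suc n) + g (suc n))) (sum1to-+ n f g))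
                             (interchange (sum1to n f) (sum1to n g) (f (suc n)) (g (suc n)))

sum1to-*ˡ : ∀ n k (f : ℕ → ℕ) → sum1to n (λ i → k * f i) ≡ k * sum1to n f
sum1to-*ˡ zero    k f = sym (*-zeroʳ k)
sum1to-*ˡ (suc n) k f = trans (cong (_+ k * f (suc n)) (sum1to-*ˡ n k f))
                              (sym (*-distribˡ-+ k (sum1to n f) (f (suc n))))

sum1to-swap : ∀ m n (h : ℕ → ℕ → ℕ) →
              sum1to m (λ i → sum1to n (h i)) ≡ sum1to n (λ c → sum1to m (λ i → h i c))
sum1to-swap zero    n h = sym (sum1to-zero n (λ _ → 0) (λ _ _ → refl))
sum1to-swap (suc m) n h = trans (cong (_+ sum1to n (h (suc m))) (sum1to-swap m n h))
                                (sym (sum1to-+ n (λ c → sum1to m (λ i → h i c)) (h (suc m))))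

sum1to-sucˡ : ∀ n (f : ℕ → ℕ) → sum1to (suc n) f ≡ f 1 + sum1to n (f ∘ suc)
sum1to-sucˡ zero    f = +-comm 0 (f 1)
sum1to-sucˡ (suc n) f = trans (cong (_+ f (suc (suc n))) (sum1to-sucˡ n f)) (+-assoc (f 1) _ _)

sumFin-cong : ∀ n {f g : Fin n → ℕ} → (∀ k → f k ≡ g k) → sumFin n f ≡ sumFin n g
sumFin-cong zero    f≡g = refl
sumFin-cong (suc n) f≡g = cong₂ _+_ (f≡g fzero) (sumFin-cong n (f≡g ∘ fsuc))

sum1to≡sumFin : ∀ n (f : ℕ → ℕ) → sum1to n f ≡ sumFin n (λ k → f (suc (toℕ k)))
sum1to≡sumFin zero    f = refl
sum1to≡sumFin (suc n) f = trans (sum1to-sucˡ n f) (cong (f 1 +_) (sum1to≡sumFin n (f ∘ suc)))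

sum1to-𝟙[≡] : ∀ n a → sum1to n (λ i → 𝟙[ i ≡ suc a ]) ≡ 𝟙[ suc a ≤ n ]
sum1to-𝟙[≡] zero    a = refl
sum1to-𝟙[≡] (suc n) a = trans (cong (_+ 𝟙[ n ≡ a ]) (sum1to-𝟙[≡] n a)) (𝟙[≤]-split a n)

-- g 0 ≡ 0 covers a = 0, which the range 1 … n misses.
sum1to-select : ∀ n a (g : ℕ → ℕ) → g 0 ≡ 0 → a ≤ n → sum1to n (λ c → g c * 𝟙[ a ≡ c ]) ≡ g a
sum1to-select zero    zero g g0≡0 z≤n = sym g0≡0
sum1to-select (suc n) a    g g0≡0 a≤1+n with a ≟ suc n
... | yes refl = begin
  sum1to n (λ c → g c * 𝟙[ suc n ≡ c ]) + g (suc n) * 𝟙[ n ≡ n ]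
    ≡⟨ cong₂ _+_ (sum1to-zero n _ λ c c<n → trans (cong (g (suc c) *_) (𝟙[≡]-≢ (<⇒≢ c<n ∘ sym)))
                                                    (*-zeroʳ (g (suc c))))
                 (cong (g (suc n) *_) (𝟙[≡]-refl n)) ⟩
  g (suc n) * 1
    ≡⟨ *-identityʳ (g (suc n)) ⟩
  g (suc n) ∎
... | no a≢1+n = begin
  sum1to n (λ c → g c * 𝟙[ a ≡ c ]) + g (suc n) * 𝟙[ a ≡ suc n ]
    ≡⟨ cong₂ _+_ (sum1to-select n a g g0≡0 (≤-pred (≤∧≢⇒< a≤1+n a≢1+n)))
                 (cong (g (suc n) *_) (𝟙[≡]-≢ a≢1+n)) ⟩
  g a + g (suc n) * 0
    ≡⟨ cong (g a +_) (*-zeroʳ (g (suc n))) ⟩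
  g a + 0
    ≡⟨ +-identityʳ (g a) ⟩
  g a ∎

walks-suc-axis : ∀ m a b c d → c ≡ 0 ⊎ d ≡ 0 → walks (suc m) (a , b) (c , d) ≡ 0
walks-suc-axis zero    a b c d (inj₁ refl) =
  sum1to-zero a _ λ i _ → same≡𝟙*𝟙 (suc b) (suc i) 0 d
walks-suc-axis zero    a b c d (inj₂ refl) =
  sum1to-zero a _ λ i _ → trans (same≡𝟙*𝟙 (suc b) (suc i) c 0) (*-zeroʳ 𝟙[ suc b ≡ c ])
walks-suc-axis (suc m) a b c d c≡0⊎d≡0 =
  sum1to-zero a _ λ i _ → walks-suc-axis m (suc b) (suc i) c d c≡0⊎d≡0

walks-last-step : ∀ m a b e f n → (∀ c → n < c → walks m (a , b) (c , e) ≡ 0) →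
                  walks (suc m) (a , b) (suc e , suc f)
                    ≡ sum1to n (λ c → 𝟙[ suc f ≤ c ] * walks m (a , b) (c , e))
walks-last-step zero a b e f n vanish = begin
  sum1to a (λ i → same (suc b , i) (suc e , suc f))
    ≡⟨ sum1to-cong a (λ i _ → same≡𝟙*𝟙 (suc b) (suc i) (suc e) (suc f)) ⟩
  sum1to a (λ i → 𝟙[ b ≡ e ] * 𝟙[ i ≡ suc f ])
    ≡⟨ sum1to-*ˡ a 𝟙[ b ≡ e ] (λ i → 𝟙[ i ≡ suc f ]) ⟩
  𝟙[ b ≡ e ] * sum1to a (λ i → 𝟙[ i ≡ suc f ])
    ≡⟨ cong (𝟙[ b ≡ e ] *_) (sum1to-𝟙[≡] a f) ⟩
  𝟙[ b ≡ e ] * 𝟙[ suc f ≤ a ]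
    ≡⟨ 𝟙[≡]*-cong b e (λ b≡e → sym (sum1to-select n a (λ c → 𝟙[ suc f ≤ c ]) refl (a≤n b≡e))) ⟩
  𝟙[ b ≡ e ] * sum1to n (λ c → 𝟙[ suc f ≤ c ] * 𝟙[ a ≡ c ])
    ≡⟨ sum1to-*ˡ n 𝟙[ b ≡ e ] (λ c → 𝟙[ suc f ≤ c ] * 𝟙[ a ≡ c ]) ⟨
  sum1to n (λ c → 𝟙[ b ≡ e ] * (𝟙[ suc f ≤ c ] * 𝟙[ a ≡ c ]))
    ≡⟨ sum1to-cong n (λ c _ → sym (trans (cong (𝟙[ suc f ≤ suc c ] *_) (same≡𝟙*𝟙 a b (suc c) e))
                                         (x∙yz≈z∙xy 𝟙[ suc f ≤ suc c ] 𝟙[ a ≡ suc c ] 𝟙[ b ≡ e ]))) ⟩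
  sum1to n (λ c → 𝟙[ suc f ≤ c ] * same (a , b) (c , e)) ∎
  where
  a≤n : b ≡ e → a ≤ n
  a≤n refl = ≮⇒≥ λ n<a → 1+n≢0 (trans (sym (same-refl a b)) (vanish a n<a))
walks-last-step (suc m) a b e f n vanish = begin
  sum1to a (λ i → walks (suc m) (suc b , i) (suc e , suc f))
    ≡⟨ sum1to-cong a (λ i i<a → walks-last-step m (suc b) (suc i) e f n
                                  λ c n<c → sum1to-zero⁻ a _ (vanish c n<c) i i<a) ⟩
  sum1to a (λ i → sum1to n (λ c → 𝟙[ suc f ≤ c ] * walks m (suc b , i) (c , e)))
    ≡⟨ sum1to-swap a n (λ i c → 𝟙[ suc f ≤ c ] * walks m (suc b , i) (c , e)) ⟩
  sum1to n (λ c → sum1to a (λ i → 𝟙[ suc f ≤ c ] * walks m (suc b , i) (c , e)))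
    ≡⟨ sum1to-cong n (λ c _ → sum1to-*ˡ a 𝟙[ suc f ≤ suc c ] _) ⟩
  sum1to n (λ c → 𝟙[ suc f ≤ c ] * sum1to a (λ i → walks m (suc b , i) (c , e))) ∎

-- The box grows alternately: rows (suc m) = cols m and cols (suc m) = suc (rows m) hold by refl.
walks-outside-box : ∀ m c d → suc (rows m) < c ⊎ cols m < d → walks m (2 , 1) (c , d) ≡ 0
walks-outside-box zero c d (inj₁ 2<c) =
  trans (same≡𝟙*𝟙 2 1 c d) (cong (_* 𝟙[ 1 ≡ d ]) (𝟙[≡]-≢ (<⇒≢ 2<c)))
walks-outside-box zero c d (inj₂ 1<d) =
  trans (same≡𝟙*𝟙 2 1 c d) (trans (cong (𝟙[ 2 ≡ c ] *_) (𝟙[≡]-≢ (<⇒≢ 1<d))) (*-zeroʳ 𝟙[ 2 ≡ c ]))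
walks-outside-box (suc m) c       zero    outside = walks-suc-axis m 2 1 c 0 (inj₂ refl)
walks-outside-box (suc m) zero    (suc f) outside = walks-suc-axis m 2 1 0 (suc f) (inj₁ refl)
walks-outside-box (suc m) (suc e) (suc f) outside =
  trans (walks-last-step m 2 1 e f (suc (rows m)) (λ c n<c → walks-outside-box m c e (inj₁ n<c)))
        (sum1to-zero (suc (rows m)) _ (term≡0 outside))
  where
  term≡0 : suc (cols m) < suc e ⊎ suc (rows m) < suc f →
           ∀ c → c < suc (rows m) → 𝟙[ suc f ≤ suc c ] * walks m (2 , 1) (suc c , e) ≡ 0
  term≡0 (inj₁ cols<e) c _ =
    trans (cong (𝟙[ f ≤ c ] *_) (walks-outside-box m (suc c) e (inj₂ (≤-pred cols<e))))
          (*-zeroʳ 𝟙[ f ≤ c ])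
  term≡0 (inj₂ rows<f) c c≤rows = cong (_* walks m (2 , 1) (suc c , e))
                                       (𝟙[≤]-> (≤-<-trans (≤-pred c≤rows) (≤-pred rows<f)))

walks-start-last-step : ∀ m e f →
  walks (suc m) (2 , 1) (suc e , suc f)
    ≡ sum1to (suc (rows m)) (λ c → 𝟙[ suc f ≤ c ] * walks m (2 , 1) (c , e))
walks-start-last-step m e f =
  walks-last-step m 2 1 e f (suc (rows m)) (λ c n<c → walks-outside-box m c e (inj₁ n<c))

walks-to-y≡0 : ∀ m c → walks m (2 , 1) (c , 0) ≡ 0
walks-to-y≡0 zero    c = trans (same≡𝟙*𝟙 2 1 c 0) (*-zeroʳ 𝟙[ 2 ≡ c ])
walks-to-y≡0 (suc m) c = walks-suc-axis m 2 1 c 0 (inj₂ refl)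

walks-to-x≡1 : ∀ m d → walks m (2 , 1) (1 , d) ≡ 0
walks-to-x≡1 zero    d       = same≡𝟙*𝟙 2 1 1 d
walks-to-x≡1 (suc m) zero    = walks-suc-axis m 2 1 1 0 (inj₂ refl)
walks-to-x≡1 (suc m) (suc f) =
  trans (walks-start-last-step m 0 f)
        (sum1to-zero (suc (rows m)) _ λ c _ →
          trans (cong (𝟙[ f ≤ c ] *_) (walks-to-y≡0 m (suc c))) (*-zeroʳ 𝟙[ f ≤ c ]))

A≡𝟙[≤] : ∀ m r c → A m r c ≡ 𝟙[ toℕ r ≤ suc (toℕ c) ]
A≡𝟙[≤] m fzero    c = refl
A≡𝟙[≤] m (fsuc r) c with suc (toℕ r) ≤? suc (toℕ c)
... | yes r≤c = sym (𝟙[≤]-≤ (≤-pred r≤c))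
... | no  r≰c = sym (𝟙[≤]-> (≰⇒> (r≰c ∘ s≤s)))

lemma3p10 : (m : ℕ) → ∀ i j → X (suc m) i j ≡ transpose (A m ⊗ X m) i j
lemma3p10 m i j = begin
  walks (suc m) (2 , 1) (suc (suc (toℕ i)) , suc (toℕ j))
    ≡⟨ walks-start-last-step m (suc (toℕ i)) (toℕ j) ⟩
  sum1to (suc (rows m)) g
    ≡⟨ sum1to-sucˡ (rows m) g ⟩
  g 1 + sum1to (rows m) (g ∘ suc)
    ≡⟨ cong (_+ sum1to (rows m) (g ∘ suc)) g1≡0 ⟩
  sum1to (rows m) (g ∘ suc)
    ≡⟨ sum1to≡sumFin (rows m) (g ∘ suc) ⟩
  sumFin (rows m) (λ k → g (suc (suc (toℕ k))))
    ≡⟨ sumFin-cong (rows m) (λ k → cong (_* X m k i) (A≡𝟙[≤] m j k)) ⟨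
  sumFin (rows m) (λ k → A m j k * X m k i) ∎
  where
  g : ℕ → ℕ
  g c = 𝟙[ suc (toℕ j) ≤ c ] * walks m (2 , 1) (c , suc (toℕ i))
  g1≡0 : g 1 ≡ 0
  g1≡0 = trans (cong (𝟙[ suc (toℕ j) ≤ 1 ] *_) (walks-to-x≡1 m (suc (toℕ i))))
               (*-zeroʳ 𝟙[ suc (toℕ j) ≤ 1 ])
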